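{- Let $S$ be a set and $\mathcal{J}$ a reduction on $S$. Then there exists a greatest saturation $\mathbb{A}(\mathcal{J})$ on $S$ compatible with $\mathcal{J}$ (i.e. with $\mathbb{A}(\mathcal{J})\triangleleft\mathcal{J}$), it coincides with the greatest operator left-compatible with $\mathcal{J}$, and it is given by: for all $a\in S$ and $U\subseteq S$, $$a\in\mathbb{A}(\mathcal{J})(U)\iff \text{for all } V\subseteq S,\ \big(a\in\mathcal{J}(V)\Rightarrow U\between\mathcal{J}(V)\big).$$ Moreover, for every saturation $\mathcal{A}$ on $S$: $\mathcal{A}\triangleleft\mathcal{J}$ if and only if $\mathcal{A}\subseteq\mathbb{A}(\mathcal{J})$.
   Context: All reasoning is intuitionistic (no law of excluded middle); impredicative constructions are allowed. An operator on $S$ is a map $\mathrm{Pow}(S)\to\mathrm{Pow}(S)$, ordered by $\mathcal{O}_1\subseteq\mathcal{O}_2$ iff $\mathcal{O}_1(U)\subseteq\mathcal{O}_2(U)$ for all $U$. For $U,V\subseteq S$, $U\between V$ means there exists $a\in U\cap V$. $\mathcal{O}\triangleleft\mathcal{O}'$ means: for all $U,V\subseteq S$, $\mathcal{O}(U)\between\mathcal{O}'(V)$ implies $U\between\mathcal{O}'(V)$. A saturation is a monotone idempotent operator $\mathcal{A}$ with $U\subseteq\mathcal{A}(U)$ for all $U$; a reduction is a monotone idempotent operator $\mathcal{J}$ with $\mathcal{J}(U)\subseteq U$ for all $U$. -}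

module Defs where

open import Level using (Level; suc; _⊔_)
open import Data.Product using (Σ; ∃; _×_; _,_)

Pow : Set → Set₁
Pow S = S → Set

_∈_ : {S : Set} → S → Pow S → Set
a ∈ U = U a

infix 4 _∈_ _⊆_ _≬_ _⊆ₒ_ _◁_

_⊆_ : {S : Set} → Pow S → Pow S → Set
U ⊆ V = ∀ a → a ∈ U → a ∈ V

_≐_ : {S : Set} → Pow S → Pow S → Set
U ≐ V = (U ⊆ V) × (V ⊆ U)

_≬_ : {S : Set} → Pow S → Pow S → Set
U ≬ V = ∃ λ a → (a ∈ U) × (a ∈ V)

Op : Set → Set₁
Op S = Pow S → Pow S

_⊆ₒ_ : {S : Set} → Op S → Op S → Set₁
O₁ ⊆ₒ O₂ = ∀ U → O₁ U ⊆ O₂ U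

_◁_ : {S : Set} → Op S → Op S → Set₁
O ◁ O' = ∀ U V → O U ≬ O' V → U ≬ O' V

Monotone : {S : Set} → Op S → Set₁
Monotone O = ∀ U V → U ⊆ V → O U ⊆ O V

Idempotent : {S : Set} → Op S → Set₁
Idempotent O = ∀ U → O (O U) ≐ O U

record IsSaturation {S : Set} (A : Op S) : Set₁ where
  field
    monotone   : Monotone A
    idempotent : Idempotent A
    reflexive  : ∀ U → U ⊆ A U

record IsReduction {S : Set} (J : Op S) : Set₁ where
  field
    monotone   : Monotone J
    idempotent : Idempotent J
    coreflexive : ∀ U → J U ⊆ U

-- Impredicativity, rendered as resizing (up to logical equivalence):
-- every large proposition P : Set₁ has a small logically equivalent copy.
Impredicative : Set₂
Impredicative = ∀ (P : Set₁) → Σ Set λ Q → (Q → P) × (P → Q)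

-- 𝔸(J) U is, by definition, the set of those a that every J-open neighbourhood
-- J V of a meets U; resizing makes this large proposition a subset of S. Left
-- compatibility O ◁ J says precisely that O U lies in that set, so 𝔸(J) is the
-- greatest operator with O ◁ J; it is a saturation because ◁ J is inherited by
-- smaller operators and U ⊆ 𝔸(J) U and 𝔸(J) (𝔸(J) U) ⊆ 𝔸(J) U both follow by
-- unfolding. None of this uses that J is a reduction.
module Submission where

open import Defs
open import Data.Product using (Σ; _×_; _,_; proj₁; proj₂)

≬-monotoneˡ : {S : Set} {U U' W : Pow S} → U ⊆ U' → U ≬ W → U' ≬ W
≬-monotoneˡ U⊆U' (b , b∈U , b∈W) = b , U⊆U' b b∈U , b∈W

◁-antitoneˡ : {S : Set} {O O' J : Op S} → O ⊆ₒ O' → O' ◁ J → O ◁ J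
◁-antitoneˡ O⊆O' O'◁J U V (b , b∈OU , b∈JV) = O'◁J U V (b , O⊆O' U b b∈OU , b∈JV)

module GreatestLeftCompatible (resize : Impredicative) {S : Set} (J : Op S) where

  MeetsEveryJOver : Pow S → S → Set₁
  MeetsEveryJOver U a = ∀ (V : Pow S) → a ∈ J V → U ≬ J V

  𝔸 : Op S
  𝔸 U a = proj₁ (resize (MeetsEveryJOver U a))

  ∈𝔸⇒ : ∀ {U a} → a ∈ 𝔸 U → MeetsEveryJOver U a
  ∈𝔸⇒ {U} {a} = proj₁ (proj₂ (resize (MeetsEveryJOver U a)))

  ⇒∈𝔸 : ∀ {U a} → MeetsEveryJOver U a → a ∈ 𝔸 U
  ⇒∈𝔸 {U} {a} = proj₂ (proj₂ (resize (MeetsEveryJOver U a)))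

  𝔸◁J : 𝔸 ◁ J
  𝔸◁J U V (b , b∈𝔸U , b∈JV) = ∈𝔸⇒ b∈𝔸U V b∈JV

  ◁J⇒⊆𝔸 : ∀ (O : Op S) → O ◁ J → O ⊆ₒ 𝔸
  ◁J⇒⊆𝔸 O O◁J U a a∈OU = ⇒∈𝔸 λ V a∈JV → O◁J U V (a , a∈OU , a∈JV)

  ⊆𝔸⇒◁J : ∀ (O : Op S) → O ⊆ₒ 𝔸 → O ◁ J
  ⊆𝔸⇒◁J O O⊆𝔸 = ◁-antitoneˡ O⊆𝔸 𝔸◁J

  𝔸-reflexive : ∀ U → U ⊆ 𝔸 U
  𝔸-reflexive U a a∈U = ⇒∈𝔸 λ V a∈JV → a , a∈U , a∈JV

  𝔸-monotone : Monotone 𝔸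
  𝔸-monotone U U' U⊆U' a a∈𝔸U = ⇒∈𝔸 λ V a∈JV → ≬-monotoneˡ U⊆U' (∈𝔸⇒ a∈𝔸U V a∈JV)

  𝔸-idempotent : Idempotent 𝔸
  𝔸-idempotent U = 𝔸𝔸U⊆𝔸U , 𝔸-reflexive (𝔸 U)
    where
    𝔸𝔸U⊆𝔸U : 𝔸 (𝔸 U) ⊆ 𝔸 U
    𝔸𝔸U⊆𝔸U a a∈𝔸𝔸U = ⇒∈𝔸 λ V a∈JV → 𝔸◁J U V (∈𝔸⇒ a∈𝔸𝔸U V a∈JV)

  𝔸-isSaturation : IsSaturation 𝔸
  𝔸-isSaturation = record
    { monotone = 𝔸-monotone ; idempotent = 𝔸-idempotent ; reflexive = 𝔸-reflexive }

corollary2p9 : Impredicative → (S : Set) (J : Op S) → IsReduction J →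
    Σ (Op S) λ 𝔸J →
    (IsSaturation 𝔸J × 𝔸J ◁ J)
    × (∀ (A : Op S) → IsSaturation A → A ◁ J → A ⊆ₒ 𝔸J)
    × (∀ (O : Op S) → O ◁ J → O ⊆ₒ 𝔸J)
    × (∀ (a : S) (U : Pow S) →
    ((a ∈ 𝔸J U) → (∀ (V : Pow S) → a ∈ J V → U ≬ J V))
    × ((∀ (V : Pow S) → a ∈ J V → U ≬ J V) → a ∈ 𝔸J U))
    × (∀ (A : Op S) → IsSaturation A → ((A ◁ J → A ⊆ₒ 𝔸J) × (A ⊆ₒ 𝔸J → A ◁ J)))
corollary2p9 resize S J _ =
  𝔸 , (𝔸-isSaturation , 𝔸◁J)
    , (λ A _ → ◁J⇒⊆𝔸 A)
    , ◁J⇒⊆𝔸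
    , (λ a U → ∈𝔸⇒ , ⇒∈𝔸)
    , (λ A _ → ◁J⇒⊆𝔸 A , ⊆𝔸⇒◁J A)
  where open GreatestLeftCompatible resize J
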